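{- For every odd integer $k>1$, the cycle $C_{2k}$ admits a $2$-graceful labeling.
   Context: $C_n$ denotes the cycle on $n$ vertices (with $n$ edges). For a graph $\Gamma$ of size $e$ and a divisor $d$ of $e$ with $e=d\cdot m$, a $d$-graceful labeling of $\Gamma$ is an injective function $f:V(\Gamma)\to\{0,1,\ldots,d(m+1)-1\}$ such that $\{|f(x)-f(y)| : [x,y]\in E(\Gamma)\}=\{1,2,\ldots,d(m+1)-1\}\setminus\{m+1,2(m+1),\ldots,(d-1)(m+1)\}$. (For $C_{2k}$ with $d=2$: $m=k$ and the labels lie in $\{0,\ldots,2k+1\}$ with edge differences exactly $\{1,\ldots,2k+1\}\setminus\{k+1\}$.) -}

module Defs where

open import Data.Nat using (ℕ; zero; suc; _+_; _*_; _<_; _≤_)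
open import Data.Fin using (Fin; toℕ; inject₁; fromℕ)
open import Data.List using (List; []; _∷_; map; length; allFin)
open import Data.List.Membership.Propositional using (_∈_)
open import Data.Product using (_×_; _,_; ∃-syntax)
open import Function.Definitions using (Injective)
open import Relation.Binary.PropositionalEquality using (_≡_)
open import Relation.Nullary using (¬_)

∣_-_∣ : ℕ → ℕ → ℕ
∣ zero  - n     ∣ = n
∣ suc m - zero  ∣ = suc m
∣ suc m - suc n ∣ = ∣ m - n ∣

record Graph : Set where
  field
    nV    : ℕ
    edges : List (Fin nV × Fin nV)
open Graph public

size : Graph → ℕ
size Γ = length (edges Γ)

cycleEdges : (n : ℕ) → List (Fin (suc n) × Fin (suc n))
cycleEdges n = (fromℕ n , Fin.zero) ∷ map (λ i → (inject₁ i , Fin.suc i)) (allFin n)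

C : (N : ℕ) → Graph
C zero    = record { nV = zero ; edges = [] }
C (suc n) = record { nV = suc n ; edges = cycleEdges n }

edgeDiffs : (Γ : Graph) → (Fin (nV Γ) → ℕ) → List ℕ
edgeDiffs Γ f = map (λ e → ∣ f (Data.Product.proj₁ e) - f (Data.Product.proj₂ e) ∣) (edges Γ)

Target : (d m x : ℕ) → Set
Target d m x = 1 ≤ x × x < d * suc m × (∀ j → 1 ≤ j → j < d → ¬ (x ≡ j * suc m))

IsDGraceful : (Γ : Graph) (d m : ℕ) → (Fin (nV Γ) → ℕ) → Set
IsDGraceful Γ d m f =
  Injective _≡_ _≡_ f ×
  (∀ v → f v < d * suc m) ×
  (∀ x → (x ∈ edgeDiffs Γ f → Target d m x) × (Target d m x → x ∈ edgeDiffs Γ f))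

DGraceful : (Γ : Graph) (d : ℕ) → Set
DGraceful Γ d = ∃[ m ] (size Γ ≡ d * m × ∃[ f ] IsDGraceful Γ d m f)

module Submission where

-- Number the vertices 0, …, 4t+1 along the cycle and group them into pairs (2j, 2j+1),
-- 0 ≤ j ≤ 2t.  With top = 4t+3 = 2(k+1)-1 the labelling is
--     j ≤ t :  2j ↦ j,          2j+1 ↦ top - j,
--     j > t :  2j ↦ top - j,    2j+1 ↦ j + 1.
-- The labels are distinct: the small ones (≤ 2t+1) are j resp. j+1, the large ones are
-- top - j, so a label determines its vertex (we exhibit a left inverse 'unlabel').
-- The path edge [i, i+1] gets the label top - i for i ≤ 2t (the labels 2t+3, …, 4t+3),
-- the label 1 for i = 2t+1, and top - 1 - i for 2t+2 ≤ i ≤ 4t (the labels 2, …, 2t);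
-- the closing edge [4t+1, 0] gets 2t+1.  Together these are exactly
-- {1, …, 2k+1} ∖ {k+1}, the target set for d = 2 and m = k.

open import Defs
open import Data.Bool using (if_then_else_)
open import Data.Empty using (⊥-elim)
open import Data.Fin using (Fin; toℕ; fromℕ<; inject₁) renaming (suc to fsuc)
open import Data.Fin.Properties using (toℕ-injective; toℕ<n; toℕ-fromℕ; toℕ-fromℕ<; toℕ-inject₁)
open import Data.List using (allFin)
open import Data.List.Properties using (length-map; length-tabulate)
open import Data.List.Membership.Propositional using (_∈_)
open import Data.List.Membership.Propositional.Properties using (∈-map⁺; ∈-map⁻; ∈-allFin)
open import Data.List.Relation.Unary.Any using (here; there)
open import Data.Nat
  using (ℕ; zero; suc; pred; _+_; _*_; _∸_; _≤_; _<_; z≤n; s≤s; z<s; _≤?_; ⌊_/2⌋; parity)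
open import Data.Nat.Divisibility using (_∣_; divides)
open import Data.Nat.Properties
open import Data.Nat.Tactic.RingSolver using (solve-∀)
open import Data.Parity.Base using (Parity; 0ℙ; 1ℙ)
open import Data.Product using (_×_; _,_; ∃-syntax; proj₁; proj₂)
open import Data.Sum using (_⊎_; inj₁; inj₂)
open import Function.Definitions using (Injective)
open import Relation.Nullary using (¬_; does; yes; no)
open import Relation.Nullary.Decidable using (dec-true; dec-false)
open import Relation.Binary.PropositionalEquality
open ≡-Reasoning

summand≤ : ∀ {y j s} → y + j ≡ s → y ≤ s
summand≤ {y} {j} refl = m≤m+n y j

≤-from-sum : ∀ {x y j s} → y + j ≡ s → x + j ≤ s → x ≤ y
≤-from-sum {x} {y} {j} refl x+j≤s = +-cancelʳ-≤ j x y x+j≤s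

≤-balance : ∀ {a b c d} → a + b ≡ c + d → b ≤ d → c ≤ a
≤-balance {c = c} eq b≤d = ≤-from-sum eq (+-monoʳ-≤ c b≤d)

half-≤ : ∀ j n → j + j ≤ suc (n + n) → j ≤ n
half-≤ j n p = ≮⇒≥ (λ n<j → <⇒≱ (subst (_≤ j + j) (cong suc (+-suc n n)) (+-mono-≤ n<j n<j)) p)

half-< : ∀ n j → n + n < j + j → n < j
half-< n j p = ≰⇒> (λ j≤n → <⇒≱ p (+-mono-≤ j≤n j≤n))

∣-∣+smaller : ∀ {x y} → x ≤ y → ∣ x - y ∣ + x ≡ y
∣-∣+smaller {y = y} z≤n = +-identityʳ y
∣-∣+smaller (s≤s x≤y)   = trans (+-suc _ _) (cong suc (∣-∣+smaller x≤y))

∣-∣-sym : ∀ x y → ∣ x - y ∣ ≡ ∣ y - x ∣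
∣-∣-sym zero    zero    = refl
∣-∣-sym zero    (suc y) = refl
∣-∣-sym (suc x) zero    = refl
∣-∣-sym (suc x) (suc y) = ∣-∣-sym x y

∣suc-∣ : ∀ y → ∣ suc y - y ∣ ≡ 1
∣suc-∣ zero    = refl
∣suc-∣ (suc y) = ∣suc-∣ y

data EvenOdd : ℕ → Set where
  even : ∀ j → EvenOdd (j + j)
  odd  : ∀ j → EvenOdd (suc (j + j))

evenOdd : ∀ i → EvenOdd i
evenOdd zero = even zero
evenOdd (suc i) with evenOdd i
... | even j = odd j
... | odd j  = subst EvenOdd (cong suc (+-suc j j)) (even (suc j))

parity-even : ∀ j → parity (j + j) ≡ 0ℙ
parity-even zero    = refl
parity-even (suc j) rewrite +-suc j j = parity-even j

parity-odd : ∀ j → parity (suc (j + j)) ≡ 1ℙ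
parity-odd zero    = refl
parity-odd (suc j) rewrite +-suc j j = parity-odd j

top : ℕ → ℕ
top t = 3 + (t + t + (t + t))

last : ℕ → ℕ
last t = suc (t + t + (t + t))

t+t≤top : ∀ t → t + t ≤ top t
t+t≤top t = m≤n⇒m≤o+n 3 (m≤m+n (t + t) (t + t))

t≤top : ∀ t → t ≤ top t
t≤top t = ≤-trans (m≤m+n t t) (t+t≤top t)

pairLabel : ℕ → ℕ → Parity → ℕ
pairLabel t j 0ℙ = if does (j ≤? t) then j else top t ∸ j
pairLabel t j 1ℙ = if does (j ≤? t) then top t ∸ j else suc j

label : ℕ → ℕ → ℕ
label t i = pairLabel t ⌊ i /2⌋ (parity i)

label-even : ∀ t j → label t (j + j) ≡ pairLabel t j 0ℙ
label-even t j rewrite sym (n≡⌊n+n/2⌋ j) | parity-even j = refl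

label-odd : ∀ t j → label t (suc (j + j)) ≡ pairLabel t j 1ℙ
label-odd t j rewrite sym (n≡⌈n+n/2⌉ j) | parity-odd j = refl

-- The labels on the four kinds of vertices.  A "mirrored" label top t - j is recorded
-- through the equation label + j = top t, which keeps truncated subtraction out of sight.
label-evenLow : ∀ {t j} → j ≤ t → label t (j + j) ≡ j
label-evenLow {t} {j} j≤t rewrite label-even t j | dec-true (j ≤? t) j≤t = refl

label-oddLow : ∀ {t j} → j ≤ t → label t (suc (j + j)) + j ≡ top t
label-oddLow {t} {j} j≤t rewrite label-odd t j | dec-true (j ≤? t) j≤t =
  m∸n+n≡m (≤-trans j≤t (t≤top t))

label-evenHigh : ∀ {t j} → t < j → j ≤ top t → label t (j + j) + j ≡ top t
label-evenHigh {t} {j} t<j j≤top rewrite label-even t j | dec-false (j ≤? t) (<⇒≱ t<j) =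
  m∸n+n≡m j≤top

label-oddHigh : ∀ {t j} → t < j → label t (suc (j + j)) ≡ suc j
label-oddHigh {t} {j} t<j rewrite label-odd t j | dec-false (j ≤? t) (<⇒≱ t<j) = refl

data Vertex (t : ℕ) : ℕ → Set where
  evenLow  : ∀ {j} → j ≤ t → Vertex t (j + j)
  oddLow   : ∀ {j} → j ≤ t → Vertex t (suc (j + j))
  evenHigh : ∀ {j} → t < j → j ≤ t + t → Vertex t (j + j)
  oddHigh  : ∀ {j} → t < j → j ≤ t + t → Vertex t (suc (j + j))

vertex : ∀ t i → i ≤ last t → Vertex t i
vertex t i i≤ with evenOdd i
... | even j with j ≤? t
...   | yes j≤t = evenLow j≤t
...   | no  j≰t = evenHigh (≰⇒> j≰t) (half-≤ j (t + t) i≤)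
vertex t i i≤ | odd j with j ≤? t
...   | yes j≤t = oddLow j≤t
...   | no  j≰t = oddHigh (≰⇒> j≰t) (half-≤ j (t + t) (m≤n⇒m≤1+n (≤-pred i≤)))

label≤top : ∀ t i → i ≤ last t → label t i ≤ top t
label≤top t i i≤ with vertex t i i≤
... | evenLow j≤t       = ≤-trans (≤-reflexive (label-evenLow j≤t)) (≤-trans j≤t (t≤top t))
... | oddLow j≤t        = summand≤ (label-oddLow j≤t)
... | evenHigh t<j j≤2t = summand≤ (label-evenHigh t<j (≤-trans j≤2t (t+t≤top t)))
... | oddHigh t<j j≤2t  =
  ≤-trans (≤-reflexive (label-oddHigh t<j)) (m≤n⇒m≤o+n 2 (s≤s (≤-trans j≤2t (m≤m+n _ _))))

-- A label v ≤ 2t+1 is the label j of the even vertex 2j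
-- (if v ≤ t) or the label j+1 of the odd vertex 2j+1 (if v > t); a larger label is
-- top t - j for a pair index j and sits on the odd vertex of that pair iff j ≤ t.
smallPosition : ℕ → ℕ → ℕ
smallPosition t v = if does (v ≤? t) then v + v else pred (v + v)

mirrorPosition : ℕ → ℕ → ℕ
mirrorPosition t j = if does (j ≤? t) then suc (j + j) else j + j

unlabel : ℕ → ℕ → ℕ
unlabel t v = if does (v ≤? suc (t + t)) then smallPosition t v else mirrorPosition t (top t ∸ v)

mirrored-large : ∀ t {y j} → y + j ≡ top t → j ≤ t + t → suc (t + t) < y
mirrored-large t sum j≤2t = ≤-from-sum sum (m≤n⇒m≤1+n (+-monoʳ-≤ (suc (suc (t + t))) j≤2t))

unlabel-mirrored : ∀ {t y j} → y + j ≡ top t → j ≤ t + t → unlabel t y ≡ mirrorPosition t j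
unlabel-mirrored {t} {y} {j} sum j≤2t
  rewrite dec-false (y ≤? suc (t + t)) (<⇒≱ (mirrored-large t sum j≤2t)) =
  cong (mirrorPosition t) (trans (cong (_∸ y) (sym sum)) (m+n∸m≡n y j))

unlabel-label : ∀ t i → i ≤ last t → unlabel t (label t i) ≡ i
unlabel-label t i i≤ with vertex t i i≤
... | evenLow {j} j≤t
  rewrite label-evenLow j≤t
        | dec-true (j ≤? suc (t + t)) (≤-trans j≤t (m≤n⇒m≤1+n (m≤m+n t t)))
        | dec-true (j ≤? t) j≤t = refl
... | oddHigh {j} t<j j≤2t
  rewrite label-oddHigh t<j
        | dec-true (suc j ≤? suc (t + t)) (s≤s j≤2t)
        | dec-false (suc j ≤? t) (<⇒≱ (m<n⇒m<1+n t<j)) = +-suc j j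
... | oddLow {j} j≤t =
  trans (unlabel-mirrored (label-oddLow j≤t) (≤-trans j≤t (m≤m+n t t)))
        (cong (λ b → if b then suc (j + j) else j + j) (dec-true (j ≤? t) j≤t))
... | evenHigh {j} t<j j≤2t =
  trans (unlabel-mirrored (label-evenHigh t<j (≤-trans j≤2t (t+t≤top t))) j≤2t)
        (cong (λ b → if b then suc (j + j) else j + j) (dec-false (j ≤? t) (<⇒≱ t<j)))

label-injective : ∀ t {i i'} → i ≤ last t → i' ≤ last t → label t i ≡ label t i' → i ≡ i'
label-injective t {i} {i'} i≤ i'≤ eq = begin
  i                      ≡⟨ sym (unlabel-label t i i≤) ⟩
  unlabel t (label t i)  ≡⟨ cong (unlabel t) eq ⟩
  unlabel t (label t i') ≡⟨ unlabel-label t i' i'≤ ⟩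
  i'                     ∎

edgeLabel : ℕ → ℕ → ℕ
edgeLabel t i = ∣ label t i - label t (suc i) ∣

label-afterOdd : ∀ t j → label t (suc (suc (j + j))) ≡ label t (suc j + suc j)
label-afterOdd t j = cong (label t) (cong suc (sym (+-suc j j)))

edge-evenLow : ∀ {t j} → j ≤ t → edgeLabel t (j + j) + (j + j) ≡ top t
edge-evenLow {t} {j} j≤t = begin
  ∣ label t (j + j) - y ∣ + (j + j) ≡⟨ cong (λ v → ∣ v - y ∣ + (j + j)) (label-evenLow j≤t) ⟩
  ∣ j - y ∣ + (j + j)               ≡⟨ sym (+-assoc _ j j) ⟩
  ∣ j - y ∣ + j + j                 ≡⟨ cong (_+ j) (∣-∣+smaller j≤y) ⟩
  y + j                             ≡⟨ sum ⟩
  top t                             ∎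
  where
  y : ℕ
  y = label t (suc (j + j))
  sum : y + j ≡ top t
  sum = label-oddLow j≤t
  j≤y : j ≤ y
  j≤y = ≤-from-sum sum (≤-trans (+-mono-≤ j≤t j≤t) (t+t≤top t))

edge-oddLow : ∀ {t j} → j < t → edgeLabel t (suc (j + j)) + suc (j + j) ≡ top t
edge-oddLow {t} {j} j<t = begin
  ∣ y - label t (suc (suc (j + j))) ∣ + suc (j + j) ≡⟨ cong (λ v → ∣ y - v ∣ + suc (j + j)) next ⟩
  ∣ y - suc j ∣ + (suc j + j)                       ≡⟨ cong (_+ (suc j + j)) (∣-∣-sym y (suc j)) ⟩
  ∣ suc j - y ∣ + (suc j + j)                       ≡⟨ sym (+-assoc _ (suc j) j) ⟩
  ∣ suc j - y ∣ + suc j + j                         ≡⟨ cong (_+ j) (∣-∣+smaller j+1≤y) ⟩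
  y + j                                             ≡⟨ sum ⟩
  top t                                             ∎
  where
  y : ℕ
  y = label t (suc (j + j))
  sum : y + j ≡ top t
  sum = label-oddLow (<⇒≤ j<t)
  next : label t (suc (suc (j + j))) ≡ suc j
  next = trans (label-afterOdd t j) (label-evenLow j<t)
  j+1≤y : suc j ≤ y
  j+1≤y = ≤-from-sum sum (≤-trans (+-mono-≤ j<t (<⇒≤ j<t)) (t+t≤top t))

edge-evenHigh : ∀ {t j} → t < j → j + j ≤ t + t + (t + t) → suc (edgeLabel t (j + j) + (j + j)) ≡ top t
edge-evenHigh {t} {j} t<j 2j≤4t = begin
  suc (∣ y - label t (suc (j + j)) ∣ + (j + j))
    ≡⟨ cong (λ v → suc (∣ y - v ∣ + (j + j))) (label-oddHigh t<j) ⟩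
  suc (∣ y - suc j ∣ + (j + j)) ≡⟨ cong (λ d → suc (d + (j + j))) (∣-∣-sym y (suc j)) ⟩
  suc (∣ suc j - y ∣ + (j + j)) ≡⟨ sym (+-suc _ (j + j)) ⟩
  ∣ suc j - y ∣ + (suc j + j)   ≡⟨ sym (+-assoc _ (suc j) j) ⟩
  ∣ suc j - y ∣ + suc j + j     ≡⟨ cong (_+ j) (∣-∣+smaller j+1≤y) ⟩
  y + j                         ≡⟨ sum ⟩
  top t                         ∎
  where
  y : ℕ
  y = label t (j + j)
  sum : y + j ≡ top t
  sum = label-evenHigh t<j (≤-trans (half-≤ j (t + t) (m≤n⇒m≤1+n 2j≤4t)) (t+t≤top t))
  j+1≤y : suc j ≤ y
  j+1≤y = ≤-from-sum sum (m≤n⇒m≤o+n 2 (s≤s 2j≤4t))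

edge-oddHigh : ∀ {t j} → t < j → j < t + t → suc (edgeLabel t (suc (j + j)) + suc (j + j)) ≡ top t
edge-oddHigh {t} {j} t<j j<2t = begin
  suc (∣ label t (suc (j + j)) - label t (suc (suc (j + j))) ∣ + suc (j + j))
    ≡⟨ cong₂ (λ a b → suc (∣ a - b ∣ + suc (j + j))) (label-oddHigh t<j) (label-afterOdd t j) ⟩
  suc (∣ suc j - y ∣ + suc (j + j)) ≡⟨ sym (+-suc _ (suc (j + j))) ⟩
  ∣ suc j - y ∣ + suc (suc (j + j)) ≡⟨ cong (∣ suc j - y ∣ +_) (cong suc (sym (+-suc j j))) ⟩
  ∣ suc j - y ∣ + (suc j + suc j)   ≡⟨ sym (+-assoc _ (suc j) (suc j)) ⟩
  ∣ suc j - y ∣ + suc j + suc j     ≡⟨ cong (_+ suc j) (∣-∣+smaller j+1≤y) ⟩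
  y + suc j                         ≡⟨ sum ⟩
  top t                             ∎
  where
  y : ℕ
  y = label t (suc j + suc j)
  sum : y + suc j ≡ top t
  sum = label-evenHigh (m<n⇒m<1+n t<j) (≤-trans j<2t (t+t≤top t))
  j+1≤y : suc j ≤ y
  j+1≤y = ≤-from-sum sum (m≤n⇒m≤o+n 3 (+-mono-≤ j<2t j<2t))

edge-low : ∀ t i → i ≤ t + t → edgeLabel t i + i ≡ top t
edge-low t i i≤2t with evenOdd i
... | even j = edge-evenLow (half-≤ j t (m≤n⇒m≤1+n i≤2t))
... | odd j  = edge-oddLow (half-< j t i≤2t)

edge-high : ∀ t i → suc (t + t) < i → i ≤ t + t + (t + t) → suc (edgeLabel t i + i) ≡ top t
edge-high t i lo hi with evenOdd i
... | even j = edge-evenHigh (half-< t j (<⇒≤ lo)) hi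
... | odd j  = edge-oddHigh (half-< t j (≤-pred lo)) (half-< j (t + t) hi)

edge-middle : ∀ t → edgeLabel t (suc (t + t)) ≡ 1
edge-middle t = begin
  ∣ label t (suc (t + t)) - label t (suc (suc (t + t))) ∣ ≡⟨ cong₂ ∣_-_∣ y₁≡ (label-afterOdd t t) ⟩
  ∣ suc y₂ - y₂ ∣                                         ≡⟨ ∣suc-∣ y₂ ⟩
  1                                                       ∎
  where
  y₂ : ℕ
  y₂ = label t (suc t + suc t)
  sum₁ : label t (suc (t + t)) + t ≡ top t
  sum₁ = label-oddLow {t} ≤-refl
  sum₂ : y₂ + suc t ≡ top t
  sum₂ = label-evenHigh (n<1+n t) (m≤n⇒m≤o+n 2 (s≤s (≤-trans (m≤m+n t t) (m≤m+n _ _))))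
  y₁≡ : label t (suc (t + t)) ≡ suc y₂
  y₁≡ = +-cancelʳ-≡ t _ _ (trans sum₁ (trans (sym sum₂) (+-suc y₂ t)))

edge-closing : ∀ t → 0 < t → ∣ label t (last t) - label t 0 ∣ ≡ suc (t + t)
edge-closing t 0<t = cong₂ ∣_-_∣ (label-oddHigh (m<m+n t 0<t)) (label-evenLow {t} z≤n)

-- For d = 2 the target set is {1, …, 2m+1} ∖ {m+1}: the only excluded multiple is m+1.
excludes-middle : ∀ {m x} → x ≢ suc m → ∀ j → 1 ≤ j → j < 2 → ¬ (x ≡ j * suc m)
excludes-middle x≢ (suc zero)    _ _ eq = x≢ (trans eq (*-identityˡ _))
excludes-middle x≢ (suc (suc j)) _ (s≤s (s≤s ()))

target-low : ∀ {m x} → 1 ≤ x → x ≤ m → Target 2 m x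
target-low {m} 1≤x x≤m =
  1≤x , ≤-trans (s≤s x≤m) (m≤m+n (suc m) _) , excludes-middle (λ eq → <-irrefl eq (s≤s x≤m))

target-high : ∀ {m x} → suc (suc m) ≤ x → x < 2 * suc m → Target 2 m x
target-high m+2≤x x<2m+2 =
  ≤-trans (s≤s z≤n) m+2≤x , x<2m+2 , excludes-middle (λ eq → <-irrefl (sym eq) m+2≤x)

target-split : ∀ {m x} → Target 2 m x → x ≤ m ⊎ suc (suc m) ≤ x
target-split {m} {x} (_ , _ , excluded) with x ≤? m
... | yes x≤m = inj₁ x≤m
... | no  x≰m = inj₂ (≤∧≢⇒< (≰⇒> x≰m) m+1≢x)
  where
  m+1≢x : suc m ≢ x
  m+1≢x eq = excluded 1 ≤-refl ≤-refl (trans (sym eq) (sym (*-identityˡ (suc m))))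

size-cycle : ∀ n → size (C (suc n)) ≡ suc n
size-cycle n = cong suc (trans (length-map _ (allFin n)) (length-tabulate (λ i → i)))

module _ (n : ℕ) (ℓ : ℕ → ℕ) where

  private
    difference : Fin (suc n) × Fin (suc n) → ℕ
    difference e = ∣ ℓ (toℕ (proj₁ e)) - ℓ (toℕ (proj₂ e)) ∣

    pathEdge : Fin n → Fin (suc n) × Fin (suc n)
    pathEdge i = inject₁ i , fsuc i

    difference-pathEdge : ∀ k → difference (pathEdge k) ≡ ∣ ℓ (toℕ k) - ℓ (suc (toℕ k)) ∣
    difference-pathEdge k = cong (λ v → ∣ ℓ v - ℓ (suc (toℕ k)) ∣) (toℕ-inject₁ k)

  cycle-diff⁻ : ∀ {x} → x ∈ edgeDiffs (C (suc n)) (λ v → ℓ (toℕ v)) →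
                x ≡ ∣ ℓ n - ℓ 0 ∣ ⊎ ∃[ i ] (i < n × x ≡ ∣ ℓ i - ℓ (suc i) ∣)
  cycle-diff⁻ (here eq) = inj₁ (trans eq (cong (λ v → ∣ ℓ v - ℓ 0 ∣) (toℕ-fromℕ n)))
  cycle-diff⁻ (there x∈) with ∈-map⁻ difference x∈
  ... | e , e∈ , refl with ∈-map⁻ pathEdge e∈
  ...   | k , _ , refl = inj₂ (toℕ k , toℕ<n k , difference-pathEdge k)

  cycle-closing∈ : ∣ ℓ n - ℓ 0 ∣ ∈ edgeDiffs (C (suc n)) (λ v → ℓ (toℕ v))
  cycle-closing∈ = here (cong (λ v → ∣ ℓ v - ℓ 0 ∣) (sym (toℕ-fromℕ n)))

  cycle-path∈ : ∀ {i} → i < n → ∣ ℓ i - ℓ (suc i) ∣ ∈ edgeDiffs (C (suc n)) (λ v → ℓ (toℕ v))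
  cycle-path∈ {i} i<n = there (subst (_∈ _) k-difference
                                     (∈-map⁺ difference (∈-map⁺ pathEdge (∈-allFin k))))
    where
    k : Fin n
    k = fromℕ< i<n
    k-difference : difference (pathEdge k) ≡ ∣ ℓ i - ℓ (suc i) ∣
    k-difference = trans (difference-pathEdge k) (cong (λ v → ∣ ℓ v - ℓ (suc v) ∣) (toℕ-fromℕ< i<n))

-- The labels stay below 2(m+1) = top t + 1, and C_(4t+2) has 2m vertices.
top+1≡2[m+1] : ∀ t → suc (3 + (t + t + (t + t))) ≡ 2 * suc (suc (t + t))
top+1≡2[m+1] = solve-∀

top<2[m+1] : ∀ t → top t < 2 * suc (suc (t + t))
top<2[m+1] t = ≤-reflexive (top+1≡2[m+1] t)

vertexCount : ∀ t → suc (suc (t + t + (t + t))) ≡ 2 * suc (t + t)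
vertexCount = solve-∀

path-edge-target : ∀ t i → i ≤ t + t + (t + t) → Target 2 (suc (t + t)) (edgeLabel t i)
path-edge-target t i i≤4t with i ≤? t + t
... | yes i≤2t = target-high (≤-from-sum sum (+-monoʳ-≤ _ i≤2t)) (≤-<-trans (summand≤ sum) (top<2[m+1] t))
  where
  sum : edgeLabel t i + i ≡ top t
  sum = edge-low t i i≤2t
... | no i≰2t with i ≟ suc (t + t)
...   | yes refl = subst (Target 2 _) (sym (edge-middle t)) (target-low ≤-refl (s≤s z≤n))
...   | no  i≢2t+1 = target-low (≤-from-sum sum (s≤s (m≤n⇒m≤1+n i≤4t))) (m≤n⇒m≤1+n (≤-balance split lo))
  where
  lo : suc (t + t) < i
  lo = ≤∧≢⇒< (≰⇒> i≰2t) (≢-sym i≢2t+1)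
  sum : edgeLabel t i + i ≡ suc (suc (t + t + (t + t)))
  sum = suc-injective (edge-high t i lo i≤4t)
  4t+2≡ : ∀ t → (t + t) + suc (suc (t + t)) ≡ suc (suc (t + t + (t + t)))
  4t+2≡ = solve-∀
  split : (t + t) + suc (suc (t + t)) ≡ edgeLabel t i + i
  split = trans (4t+2≡ t) (sym sum)

-- Every target label x ≥ 2t+3 is carried by the path edge [i, i+1] with i = top t - x ≤ 2t.
high-label-realised : ∀ t {x} → suc (suc (suc (t + t))) ≤ x → x < 2 * suc (suc (t + t)) →
                      ∃[ i ] (i ≤ t + t × edgeLabel t i ≡ x)
high-label-realised t {x} lo hi with m≤n⇒∃[o]m+o≡n (≤-pred (subst (x <_) (sym (top+1≡2[m+1] t)) hi))
... | i , x+i≡top = i , i≤2t , +-cancelʳ-≡ i _ _ (trans (edge-low t i i≤2t) (sym x+i≡top))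
  where
  i≤2t : i ≤ t + t
  i≤2t = ≤-balance (trans (+-comm (t + t) _) (trans (sym x+i≡top) (+-comm x i))) lo

-- Every target label 2 ≤ x ≤ 2t is carried by the path edge [i, i+1] with i = 4t+2 - x.
low-label-realised : ∀ t {x} → 2 ≤ x → x ≤ t + t →
                     ∃[ i ] (suc (t + t) < i × i ≤ t + t + (t + t) × edgeLabel t i ≡ x)
low-label-realised t {x} 2≤x x≤2t with m≤n⇒∃[o]m+o≡n (m≤n⇒m≤o+n 2 (≤-trans x≤2t (m≤m+n _ _)))
... | i , x+i≡ = i , lo , hi ,
  +-cancelʳ-≡ i _ _ (suc-injective (trans (edge-high t i lo hi) (sym (cong suc x+i≡))))
  where
  lo : suc (t + t) < i
  lo = ≤-balance (trans (+-comm i x) x+i≡) x≤2t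
  hi : i ≤ t + t + (t + t)
  hi = ≤-balance (trans (+-comm (t + t + (t + t)) 2) (trans (sym x+i≡) (+-comm x i))) 2≤x

IsEdgeLabel : ℕ → ℕ → Set
IsEdgeLabel t x = x ∈ edgeDiffs (C (suc (last t))) (λ v → label t (toℕ v))

edge-labels⊆target : ∀ t → 0 < t → ∀ {x} → IsEdgeLabel t x → Target 2 (suc (t + t)) x
edge-labels⊆target t 0<t x∈ with cycle-diff⁻ (last t) (label t) x∈
... | inj₁ refl = subst (Target 2 _) (sym (edge-closing t 0<t)) (target-low (s≤s z≤n) ≤-refl)
... | inj₂ (i , i<last , refl) = path-edge-target t i (≤-pred i<last)

target⊆edge-labels : ∀ t → 0 < t → ∀ {x} → Target 2 (suc (t + t)) x → IsEdgeLabel t x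
target⊆edge-labels t 0<t {x} tgt@(1≤x , x<bound , _) with target-split tgt
... | inj₂ lo =
  let i , i≤2t , eq = high-label-realised t lo x<bound
  in subst (IsEdgeLabel t) eq (cycle-path∈ (last t) (label t) (s≤s (≤-trans i≤2t (m≤m+n _ _))))
... | inj₁ x≤2t+1 with x ≟ suc (t + t)
...   | yes refl = subst (IsEdgeLabel t) (edge-closing t 0<t) (cycle-closing∈ (last t) (label t))
...   | no x≢2t+1 with x ≟ 1
...     | yes refl = subst (IsEdgeLabel t) (edge-middle t) (cycle-path∈ (last t) (label t) middle<last)
  where
  middle<last : suc (t + t) < last t
  middle<last = s≤s (m<m+n (t + t) (≤-trans 0<t (m≤m+n t t)))
...     | no x≢1 =
  let i , _ , i≤4t , eq = low-label-realised t (≤∧≢⇒< 1≤x (≢-sym x≢1)) (≤-pred (≤∧≢⇒< x≤2t+1 x≢2t+1))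
  in subst (IsEdgeLabel t) eq (cycle-path∈ (last t) (label t) (s≤s i≤4t))

label-graceful : ∀ t → 0 < t → DGraceful (C (suc (last t))) 2
label-graceful t 0<t =
  suc (t + t) , trans (size-cycle (last t)) (vertexCount t) , f , injective ,
  (λ v → ≤-<-trans (label≤top t _ (vertex≤ v)) (top<2[m+1] t)) ,
  λ x → edge-labels⊆target t 0<t , target⊆edge-labels t 0<t
  where
  f : Fin (suc (last t)) → ℕ
  f v = label t (toℕ v)
  vertex≤ : ∀ v → toℕ v ≤ last t
  vertex≤ v = ≤-pred (toℕ<n v)
  injective : Injective _≡_ _≡_ f
  injective {v} {w} eq = toℕ-injective (label-injective t (vertex≤ v) (vertex≤ w) eq)

theorem4p4 : (k : ℕ) → ¬ (2 ∣ k) → 1 < k → DGraceful (C (2 * k)) 2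
theorem4p4 k 2∤k 1<k with evenOdd k
... | even j      = ⊥-elim (2∤k (divides j (double≡ j)))
  where
  double≡ : ∀ j → j + j ≡ j * 2
  double≡ = solve-∀
... | odd zero    = ⊥-elim (<-irrefl refl 1<k)
... | odd (suc u) = subst (λ N → DGraceful (C N) 2) (vertexCount (suc u)) (label-graceful (suc u) z<s)
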